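{- Let $q>2$ be even and let $\mathcal{E}$ be a set of solids of $\mathrm{PG}(4,q)$ such that every point of $\mathrm{PG}(4,q)$ lies in either $0$, $\frac12q^3$ or $\frac12(q^3-q^2)$ solids of $\mathcal{E}$, and every plane lies in either $0$, $\frac12q$ or $q$ solids of $\mathcal{E}$. If $|\mathcal{E}|=\frac12q^2(q^2-1)$, then $\mathrm{PG}(4,q)$ contains exactly $q^3+q^2+q+1$ black points, $q^4-1$ white points and one red point.
   Context: A solid of $\mathrm{PG}(4,q)$ is a hyperplane. A point is called red if it lies in $0$ solids of $\mathcal{E}$, white if it lies in $\frac12q^3$ solids of $\mathcal{E}$, and black if it lies in $\frac12(q^3-q^2)$ solids of $\mathcal{E}$. -}

module Defs where

open import Level using (0ℓ)
open import Algebra.Bundles using (CommutativeRing)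
open import Data.Nat using (ℕ; zero; suc)
open import Data.Fin using (Fin)
open import Data.List using (List; []; [_]; map; concatMap; filterᵇ; length; allFin; foldr)
open import Data.Bool using (Bool; true; false; if_then_else_; _∧_; not; _∨_)
open import Data.Vec.Functional using (Vector; head; tail) renaming (_∷_ to _∷ᵥ_)
open import Data.Product using (∃)
open import Relation.Binary.PropositionalEquality using (_≡_)
open import Relation.Binary.Definitions using (Decidable)
open import Relation.Nullary using (¬_; does)

record FiniteField (q : ℕ) : Set₁ where
  field
    commRing : CommutativeRing 0ℓ 0ℓ
  open CommutativeRing commRing public hiding (ring)
  field
    0≉1       : ¬ (0# ≈ 1#)
    inverse   : ∀ x → ¬ (x ≈ 0#) → ∃ λ y → x * y ≈ 1#
    _≟_       : Decidable _≈_
    enum      : Fin q → Carrier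
    enum-inj  : ∀ i j → enum i ≈ enum j → i ≡ j
    enum-surj : ∀ x → ∃ λ i → enum i ≈ x

-- Points (and, dually, solids = hyperplanes) are represented by their unique
-- normalised homogeneous coordinate vectors in F^5 (first nonzero entry = 1).
module PG {q : ℕ} (F : FiniteField q) where
  open FiniteField F

  _==_ : Carrier → Carrier → Bool
  x == y = does (x ≟ y)

  V5 : Set
  V5 = Vector Carrier 5

  allVecs : (n : ℕ) → List (Vector Carrier n)
  allVecs zero    = [ (λ ()) ]
  allVecs (suc n) = concatMap (λ a → map (λ v → a ∷ᵥ v) (allVecs n)) (map enum (allFin q))

  isNormalised : (n : ℕ) → Vector Carrier n → Bool
  isNormalised zero    v = false
  isNormalised (suc n) v = if head v == 0# then isNormalised n (tail v) else head v == 1#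

  points : List V5
  points = filterᵇ (isNormalised 5) (allVecs 5)

  -- canonical representatives of the solids (hyperplanes) of PG(4,q):
  -- the solid with dual coordinates u is { x : u · x = 0 }
  solids : List V5
  solids = points

  dot : V5 → V5 → Carrier
  dot u x = foldr _+_ 0# (map (λ i → u i * x i) (allFin 5))

  onSolid : V5 → V5 → Bool
  onSolid x u = dot u x == 0#

  count : {A : Set} → (A → Bool) → List A → ℕ
  count p xs = length (filterᵇ p xs)

  allᵇ : {A : Set} → (A → Bool) → List A → Bool
  allᵇ p xs = foldr (λ x b → p x ∧ b) true xs

  -- A plane is the intersection of two distinct solids u ≠ v (given by
  -- distinct normalised dual vectors); every plane arises this way.
  planeInSolid : V5 → V5 → V5 → Bool
  planeInSolid u v w = allᵇ (λ x → not (onSolid x u ∧ onSolid x v) ∨ onSolid x w) points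

  distinctVec : V5 → V5 → Bool
  distinctVec u v = not (allᵇ (λ i → u i == v i) (allFin 5))

  pointDeg : (V5 → Bool) → V5 → ℕ
  pointDeg E x = count (λ u → E u ∧ onSolid x u) solids

  planeDeg : (V5 → Bool) → V5 → V5 → ℕ
  planeDeg E u v = count (λ w → E w ∧ planeInSolid u v w) solids

  sizeE : (V5 → Bool) → ℕ
  sizeE E = count E solids

module Submission where

-- Let deg x be the number of solids of E through the point x.  By hypothesis deg
-- takes only the values 0 (red), white = kq² and black = kq² - kq; let c₀, cw, cb be
-- the numbers of points of each colour.  Write θ n = 1 + q + ⋯ + q^(n-1) for the
-- number of points of PG(n-1,q).  A solid has θ 4 points and two distinct solids
-- meet in a plane of θ 3 points, so double counting incidences gives
--   c₀ + cw + cb = θ 5,   white·cw + black·cb = |E|·θ 4,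
--   white²·cw + black²·cb = ∑ₓ deg(x)² = |E|·(θ 3·|E| + q³).
-- As white ≠ black are nonzero, the last two equations determine cw and cb, and for
-- |E| = kq(q² - 1) they give cb = θ 4, cw = q⁴ - 1, hence c₀ = 1.

open import Defs
open import Data.Nat using (ℕ; _+_; _*_; _∸_; _^_; _<_)
open import Data.Bool using (Bool; true)
open import Data.Sum using (_⊎_)
open import Data.Product using (_×_)
open import Data.List.Membership.Propositional using (_∈_)
open import Relation.Binary.PropositionalEquality using (_≡_)
open import Data.Nat using (_≡ᵇ_)

open import Algebra.Bundles using (CommutativeRing)
open import Data.Nat using (zero; suc; NonZero; >-nonZero; >-nonZero⁻¹; ≢-nonZero⁻¹)
import Data.Nat.Properties as ℕ
open import Data.Nat.ListAction using (sum)
open import Data.Nat.Solver using (module +-*-Solver)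
open import Data.Nat.Tactic.RingSolver using (solve-∀)
open import Data.Bool using (false; if_then_else_; _∧_; not; T; T?)
open import Data.Bool.Properties using (∧-identityʳ; ∧-zeroʳ; ∧-idem; T-≡)
open import Data.List using (List; []; _∷_; map; concatMap; filterᵇ; length; _++_; tabulate; allFin)
open import Data.List.Properties using (filter-some; filter-++; length-++; length-map; length-tabulate; map-∘; map-tabulate; tabulate-cong)
open import Data.List.Membership.Propositional using (lose)
open import Data.List.Membership.Propositional.Properties using (∈-filter⁻)
open import Data.List.Relation.Unary.Any using (here; there)
open import Data.Fin using (Fin)
import Data.Fin as Fin
open import Data.Fin.Properties using (nonZeroIndex)
open import Data.Vec.Functional using (Vector; head; tail) renaming (_∷_ to _∷ᵥ_)
open import Data.Sum using (inj₁; inj₂)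
open import Data.Product using (_,_; proj₁; proj₂; map₁)
open import Data.Empty using (⊥-elim)
open import Function using (_∘_; id; Equivalence)
open import Relation.Binary.PropositionalEquality using (_≢_; refl; sym; trans; cong; cong₂; subst; module ≡-Reasoning)
open import Relation.Nullary using (¬_; does; yes; no)
import Relation.Binary.Reasoning.Setoid
open +-*-Solver using (Polynomial; solve; _:+_; _:*_; _:^_; _:=_; con)

𝟙 : Bool → ℕ
𝟙 b = if b then 1 else 0

∑ : {A : Set} → List A → (A → ℕ) → ℕ
∑ xs f = sum (map f xs)

count : {A : Set} → (A → Bool) → List A → ℕ
count p xs = length (filterᵇ p xs)

𝟙-∧ : ∀ a b → 𝟙 a * 𝟙 b ≡ 𝟙 (a ∧ b)
𝟙-∧ true  b = ℕ.*-identityˡ (𝟙 b)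
𝟙-∧ false b = refl

module _ {A : Set} where

  ∑-cong : {f g : A → ℕ} (xs : List A) → (∀ x → x ∈ xs → f x ≡ g x) → ∑ xs f ≡ ∑ xs g
  ∑-cong []       f≡g = refl
  ∑-cong (x ∷ xs) f≡g = cong₂ _+_ (f≡g x (here refl)) (∑-cong xs (λ y y∈xs → f≡g y (there y∈xs)))

  ∑-+ : (f g : A → ℕ) (xs : List A) → ∑ xs (λ x → f x + g x) ≡ ∑ xs f + ∑ xs g
  ∑-+ f g []       = refl
  ∑-+ f g (x ∷ xs) = trans (cong (f x + g x +_) (∑-+ f g xs)) (interchange (f x) (g x) _ _)
    where open import Algebra.Properties.CommutativeSemigroup ℕ.+-commutativeSemigroup using (interchange)

  ∑-*ˡ : (c : ℕ) (f : A → ℕ) (xs : List A) → ∑ xs (λ x → c * f x) ≡ c * ∑ xs f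
  ∑-*ˡ c f []       = sym (ℕ.*-zeroʳ c)
  ∑-*ˡ c f (x ∷ xs) = trans (cong (c * f x +_) (∑-*ˡ c f xs)) (sym (ℕ.*-distribˡ-+ c (f x) _))

  ∑-*ʳ : (c : ℕ) (f : A → ℕ) (xs : List A) → ∑ xs (λ x → f x * c) ≡ ∑ xs f * c
  ∑-*ʳ c f xs = trans (∑-cong xs (λ x _ → ℕ.*-comm (f x) c)) (trans (∑-*ˡ c f xs) (ℕ.*-comm c _))

  ∑-const : (c : ℕ) (xs : List A) → ∑ xs (λ _ → c) ≡ length xs * c
  ∑-const c []       = refl
  ∑-const c (x ∷ xs) = cong (c +_) (∑-const c xs)

  ∑-zero : (xs : List A) → ∑ xs (λ _ → 0) ≡ 0
  ∑-zero xs = trans (∑-const 0 xs) (ℕ.*-zeroʳ (length xs))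

  ∑-square : (f : A → ℕ) (xs : List A) → ∑ xs f * ∑ xs f ≡ ∑ xs (λ u → ∑ xs (λ v → f u * f v))
  ∑-square f xs = trans (sym (∑-*ʳ (∑ xs f) f xs)) (∑-cong xs (λ u _ → sym (∑-*ˡ (f u) f xs)))

  count≡∑𝟙 : (p : A → Bool) (xs : List A) → count p xs ≡ ∑ xs (𝟙 ∘ p)
  count≡∑𝟙 p []       = refl
  count≡∑𝟙 p (x ∷ xs) with p x
  ... | true  = cong suc (count≡∑𝟙 p xs)
  ... | false = count≡∑𝟙 p xs

  ∑-𝟙-* : (p : A → Bool) (c : ℕ) (xs : List A) → ∑ xs (λ x → 𝟙 (p x) * c) ≡ count p xs * c
  ∑-𝟙-* p c xs = trans (∑-*ʳ c (𝟙 ∘ p) xs) (cong (_* c) (sym (count≡∑𝟙 p xs)))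

  count-cong : {p p′ : A → Bool} (xs : List A) → (∀ x → x ∈ xs → p x ≡ p′ x) → count p xs ≡ count p′ xs
  count-cong xs p≡p′ =
    trans (count≡∑𝟙 _ xs) (trans (∑-cong xs (λ x x∈xs → cong 𝟙 (p≡p′ x x∈xs))) (sym (count≡∑𝟙 _ xs)))

  count-split : (r p : A → Bool) (xs : List A) →
    count (λ x → r x ∧ not (p x)) xs + count (λ x → r x ∧ p x) xs ≡ count r xs
  count-split r p [] = refl
  count-split r p (x ∷ xs) with r x | p x
  ... | false | _     = count-split r p xs
  ... | true  | true  = trans (ℕ.+-suc _ _) (cong suc (count-split r p xs))
  ... | true  | false = cong suc (count-split r p xs)

  count-filter : (p r : A → Bool) (xs : List A) → count p (filterᵇ r xs) ≡ count (λ x → r x ∧ p x) xs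
  count-filter p r [] = refl
  count-filter p r (x ∷ xs) with r x
  ... | false = count-filter p r xs
  ... | true with p x
  ...   | true  = cong suc (count-filter p r xs)
  ...   | false = count-filter p r xs

∑-swap : {A B : Set} (f : A → B → ℕ) (xs : List A) (ys : List B) →
  ∑ xs (λ x → ∑ ys (f x)) ≡ ∑ ys (λ y → ∑ xs (λ x → f x y))
∑-swap f []       ys = sym (∑-zero ys)
∑-swap f (x ∷ xs) ys = trans (cong (∑ ys (f x) +_) (∑-swap f xs ys)) (sym (∑-+ (f x) _ ys))

count-map : {A B : Set} (p : B → Bool) (g : A → B) (xs : List A) → count p (map g xs) ≡ count (p ∘ g) xs
count-map p g []       = refl
count-map p g (x ∷ xs) with p (g x)
... | true  = cong suc (count-map p g xs)
... | false = count-map p g xs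

count-concatMap : {A B : Set} (p : B → Bool) (f : A → List B) (xs : List A) →
  count p (concatMap f xs) ≡ ∑ xs (λ x → count p (f x))
count-concatMap p f []       = refl
count-concatMap p f (x ∷ xs) = begin
  count p (f x ++ concatMap f xs)
    ≡⟨ cong length (filter-++ (T? ∘ p) (f x) (concatMap f xs)) ⟩
  length (filterᵇ p (f x) ++ filterᵇ p (concatMap f xs))
    ≡⟨ length-++ (filterᵇ p (f x)) ⟩
  count p (f x) + count p (concatMap f xs)
    ≡⟨ cong (count p (f x) +_) (count-concatMap p f xs) ⟩
  count p (f x) + ∑ xs (λ y → count p (f y)) ∎
  where open ≡-Reasoning

module _ {A : Set} (r p : A → Bool) where

  count-∧-≡0 : (ys : List A) → count p ys ≡ 0 → count (λ y → r y ∧ p y) ys ≡ 0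
  count-∧-≡0 []       _     = refl
  count-∧-≡0 (y ∷ ys) #p≡0 with p y
  ... | false rewrite ∧-zeroʳ (r y) = count-∧-≡0 ys #p≡0

  count-∧-singleton : (xs : List A) (x : A) → x ∈ xs → p x ≡ true → count p xs ≡ 1 →
    count (λ y → r y ∧ p y) xs ≡ 𝟙 (r x)
  count-∧-singleton (y ∷ ys) x (here refl) px≡true #p≡1 rewrite px≡true with r x
  ... | true  = cong suc (count-∧-≡0 ys (ℕ.suc-injective #p≡1))
  ... | false = count-∧-≡0 ys (ℕ.suc-injective #p≡1)
  count-∧-singleton (y ∷ ys) x (there x∈ys) px≡true #p≡1 with p y
  ... | true  = ⊥-elim (ℕ.<⇒≢ (filter-some (T? ∘ p) (lose x∈ys (Equivalence.from T-≡ px≡true)))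
                               (sym (ℕ.suc-injective #p≡1)))
  ... | false rewrite ∧-zeroʳ (r y) = count-∧-singleton ys x x∈ys px≡true #p≡1

true≢false : true ≢ false
true≢false ()

∧-true₁ : ∀ {a b} → (a ∧ b) ≡ true → a ≡ true
∧-true₁ {true} _ = refl

∧-true₂ : ∀ {a b} → (a ∧ b) ≡ true → b ≡ true
∧-true₂ {true} b≡true = b≡true

≡ᵇ-refl : ∀ n → (n ≡ᵇ n) ≡ true
≡ᵇ-refl n = Equivalence.to T-≡ (ℕ.≡⇒≡ᵇ n n refl)

≡ᵇ-≢ : ∀ m n → m ≢ n → (m ≡ᵇ n) ≡ false
≡ᵇ-≢ m n m≢n with m ≡ᵇ n in eq
... | false = refl
... | true  = ⊥-elim (m≢n (ℕ.≡ᵇ⇒≡ m n (subst T (sym eq) _)))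

module ThreeValued {A : Set} (f : A → ℕ) {a b : ℕ} (a≢0 : a ≢ 0) (b≢0 : b ≢ 0) (a≢b : a ≢ b) where

  Values : List A → Set
  Values xs = ∀ x → x ∈ xs → f x ≡ 0 ⊎ f x ≡ a ⊎ f x ≡ b

  level : ℕ → List A → ℕ
  level c xs = count (λ x → f x ≡ᵇ c) xs

  decompose : (g : ℕ → ℕ) (y : ℕ) → y ≡ 0 ⊎ y ≡ a ⊎ y ≡ b →
    g y ≡ g 0 * 𝟙 (y ≡ᵇ 0) + g a * 𝟙 (y ≡ᵇ a) + g b * 𝟙 (y ≡ᵇ b)
  decompose g .0 (inj₁ refl)
    rewrite ≡ᵇ-≢ 0 a (a≢0 ∘ sym) | ≡ᵇ-≢ 0 b (b≢0 ∘ sym) = first (g 0) (g a) (g b)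
    where
    first : ∀ x y z → x ≡ x * 1 + y * 0 + z * 0
    first = solve-∀
  decompose g .a (inj₂ (inj₁ refl))
    rewrite ≡ᵇ-≢ a 0 a≢0 | ≡ᵇ-refl a | ≡ᵇ-≢ a b a≢b = second (g 0) (g a) (g b)
    where
    second : ∀ x y z → y ≡ x * 0 + y * 1 + z * 0
    second = solve-∀
  decompose g .b (inj₂ (inj₂ refl))
    rewrite ≡ᵇ-≢ b 0 b≢0 | ≡ᵇ-≢ b a (a≢b ∘ sym) | ≡ᵇ-refl b = third (g 0) (g a) (g b)
    where
    third : ∀ x y z → z ≡ x * 0 + y * 0 + z * 1
    third = solve-∀

  moment : (g : ℕ → ℕ) (xs : List A) → Values xs →
    ∑ xs (g ∘ f) ≡ g 0 * level 0 xs + g a * level a xs + g b * level b xs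
  moment g xs values = begin
    ∑ xs (g ∘ f)
      ≡⟨ ∑-cong xs (λ x x∈xs → decompose g (f x) (values x x∈xs)) ⟩
    ∑ xs (λ x → g 0 * 𝟙 (f x ≡ᵇ 0) + g a * 𝟙 (f x ≡ᵇ a) + g b * 𝟙 (f x ≡ᵇ b))
      ≡⟨ trans (∑-+ _ _ xs) (cong (_+ _) (∑-+ _ _ xs)) ⟩
    ∑ xs (λ x → g 0 * 𝟙 (f x ≡ᵇ 0)) + ∑ xs (λ x → g a * 𝟙 (f x ≡ᵇ a)) + ∑ xs (λ x → g b * 𝟙 (f x ≡ᵇ b))
      ≡⟨ cong₂ _+_ (cong₂ _+_ (levelTerm 0) (levelTerm a)) (levelTerm b) ⟩
    g 0 * level 0 xs + g a * level a xs + g b * level b xs ∎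
    where
    open ≡-Reasoning
    levelTerm : ∀ c → ∑ xs (λ x → g c * 𝟙 (f x ≡ᵇ c)) ≡ g c * level c xs
    levelTerm c = trans (∑-*ˡ (g c) _ xs) (cong (g c *_) (sym (count≡∑𝟙 _ xs)))

  levels-total : (xs : List A) → Values xs →
    level 0 xs + level a xs + level b xs ≡ count (λ _ → true) xs
  levels-total xs values = begin
    level 0 xs + level a xs + level b xs
      ≡⟨ cong₂ _+_ (cong₂ _+_ (ℕ.*-identityˡ (level 0 xs)) (ℕ.*-identityˡ (level a xs)))
                   (ℕ.*-identityˡ (level b xs)) ⟨
    1 * level 0 xs + 1 * level a xs + 1 * level b xs
      ≡⟨ moment (λ _ → 1) xs values ⟨
    ∑ xs (λ _ → 1)
      ≡⟨ count≡∑𝟙 (λ _ → true) xs ⟨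
    count (λ _ → true) xs ∎
    where open ≡-Reasoning

  levels-first : (xs : List A) → Values xs →
    ∑ xs f ≡ a * level a xs + b * level b xs
  levels-first = moment (λ y → y)

  levels-second : (xs : List A) → Values xs →
    ∑ xs (λ x → f x * f x) ≡ a * a * level a xs + b * b * level b xs
  levels-second = moment (λ y → y * y)

θ : ℕ → ℕ → ℕ
θ q zero    = 0
θ q (suc n) = θ q n + q ^ n

∑-tabulate-delta : ∀ {n} (j : Fin n) c → sum (tabulate (λ i → if does (i Fin.≟ j) then c else 0)) ≡ c
∑-tabulate-delta {suc n} Fin.zero    c = trans (cong (c +_) (others n)) (ℕ.+-identityʳ c)
  where
  others : ∀ m → sum (tabulate (λ (i : Fin m) → if does (Fin.suc i Fin.≟ Fin.zero) then c else 0)) ≡ 0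
  others zero    = refl
  others (suc m) = others m
∑-tabulate-delta {suc n} (Fin.suc j) c = ∑-tabulate-delta j c

module LinearCounting {q : ℕ} (F : FiniteField q) where
  open FiniteField F hiding (zero)
    renaming (_+_ to _⊕_; _*_ to _⊗_; -_ to ⊖_; refl to ≈-refl; sym to ≈-sym; trans to ≈-trans)
  open PG F using (_==_; allVecs; isNormalised)
  open import Algebra.Properties.Group +-group using (inverseˡ-unique; inverseʳ-unique)
  open import Algebra.Properties.Ring (CommutativeRing.ring commRing) using (-‿distribˡ-*)
  open import Algebra.Properties.CommutativeSemigroup +-commutativeSemigroup using (interchange)
  module ≈-Reasoning = Relation.Binary.Reasoning.Setoid setoid

  ==-sound : ∀ {x y} → (x == y) ≡ true → x ≈ y
  ==-sound {x} {y} _ with x ≟ y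
  ... | yes x≈y = x≈y

  ==-complete : ∀ {x y} → x ≈ y → (x == y) ≡ true
  ==-complete {x} {y} x≈y with x ≟ y
  ... | yes _   = refl
  ... | no x≉y = ⊥-elim (x≉y x≈y)

  ==-refute : ∀ {x y} → ¬ x ≈ y → (x == y) ≡ false
  ==-refute {x} {y} x≉y with x ≟ y
  ... | yes x≈y = ⊥-elim (x≉y x≈y)
  ... | no _    = refl

  ==-false : ∀ {x y} → (x == y) ≡ false → ¬ x ≈ y
  ==-false {x} {y} _ with x ≟ y
  ... | no x≉y = x≉y

  ==-iff : ∀ {x y z w} → (x ≈ y → z ≈ w) → (z ≈ w → x ≈ y) → (x == y) ≡ (z == w)
  ==-iff {z = z} {w} to from with z ≟ w
  ... | yes z≈w = ==-complete (from z≈w)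
  ... | no z≉w  = ==-refute (λ x≈y → z≉w (to x≈y))

  ==-respˡ : ∀ {x y z} → x ≈ y → (x == z) ≡ (y == z)
  ==-respˡ x≈y = ==-iff (≈-trans (≈-sym x≈y)) (≈-trans x≈y)

  elements : List Carrier
  elements = map enum (allFin q)

  q-nonZero : NonZero q
  q-nonZero = nonZeroIndex (proj₁ (enum-surj 0#))

  ∑F-const : ∀ c → ∑ elements (λ _ → c) ≡ q * c
  ∑F-const c = trans (∑-const c elements)
                     (cong (_* c) (trans (length-map enum (allFin q)) (length-tabulate {n = q} id)))

  ∑F-delta : ∀ x c → ∑ elements (λ a → if a == x then c else 0) ≡ c
  ∑F-delta x c = begin
    sum (map h (map enum (allFin q)))  ≡⟨ cong sum (sym (map-∘ (allFin q))) ⟩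
    sum (map (h ∘ enum) (allFin q))    ≡⟨ cong sum (map-tabulate id (h ∘ enum)) ⟩
    sum (tabulate (h ∘ enum))          ≡⟨ cong sum (tabulate-cong agree) ⟩
    sum (tabulate δ)                   ≡⟨ ∑-tabulate-delta i₀ c ⟩
    c                                  ∎
    where
    h : Carrier → ℕ
    h a = if a == x then c else 0
    i₀ : Fin q
    i₀ = proj₁ (enum-surj x)
    δ : Fin q → ℕ
    δ i = if does (i Fin.≟ i₀) then c else 0
    open ≡-Reasoning
    agree : ∀ i → h (enum i) ≡ δ i
    agree i with enum i ≟ x | i Fin.≟ i₀
    ... | yes _     | yes _    = refl
    ... | no _      | no _     = refl
    ... | yes eᵢ≈x  | no i≢i₀  = ⊥-elim (i≢i₀ (enum-inj i i₀ (≈-trans eᵢ≈x (≈-sym (proj₂ (enum-surj x))))))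
    ... | no eᵢ≉x   | yes refl = ⊥-elim (eᵢ≉x (proj₂ (enum-surj x)))

  unique-root : ∀ c d → ¬ d ≈ 0# → ∑ elements (λ a → 𝟙 ((c ⊕ d ⊗ a) == 0#)) ≡ 1
  unique-root c d d≉0 =
    trans (∑-cong elements (λ a _ → cong 𝟙 (==-iff (is-root a) (root-is-root a)))) (∑F-delta r 1)
    where
    open ≈-Reasoning
    d⁻¹ : Carrier
    d⁻¹ = proj₁ (inverse d d≉0)
    dd⁻¹≈1 : d ⊗ d⁻¹ ≈ 1#
    dd⁻¹≈1 = proj₂ (inverse d d≉0)
    r : Carrier
    r = d⁻¹ ⊗ ⊖ c
    is-root : ∀ a → c ⊕ d ⊗ a ≈ 0# → a ≈ r
    is-root a c+da≈0 = begin
      a               ≈⟨ ≈-sym (*-identityˡ a) ⟩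
      1# ⊗ a          ≈⟨ *-congʳ (≈-trans (≈-sym dd⁻¹≈1) (*-comm d d⁻¹)) ⟩
      (d⁻¹ ⊗ d) ⊗ a   ≈⟨ *-assoc d⁻¹ d a ⟩
      d⁻¹ ⊗ (d ⊗ a)   ≈⟨ *-congˡ (inverseʳ-unique c (d ⊗ a) c+da≈0) ⟩
      r               ∎
    root-is-root : ∀ a → a ≈ r → c ⊕ d ⊗ a ≈ 0#
    root-is-root a a≈r = begin
      c ⊕ d ⊗ a            ≈⟨ +-congˡ (*-congˡ a≈r) ⟩
      c ⊕ d ⊗ (d⁻¹ ⊗ ⊖ c)  ≈⟨ +-congˡ (≈-sym (*-assoc d d⁻¹ (⊖ c))) ⟩
      c ⊕ (d ⊗ d⁻¹) ⊗ ⊖ c  ≈⟨ +-congˡ (≈-trans (*-congʳ dd⁻¹≈1) (*-identityˡ (⊖ c))) ⟩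
      c ⊕ ⊖ c              ≈⟨ -‿inverseʳ c ⟩
      0#                   ∎

  root-count : ∀ U V →
    ∑ elements (λ l → 𝟙 ((U ⊕ V ⊗ l) == 0#)) ≡ 𝟙 (not (V == 0#)) + q * 𝟙 ((U == 0#) ∧ (V == 0#))
  root-count U V with V ≟ 0#
  ... | yes V≈0 = begin
    ∑ elements (λ l → 𝟙 ((U ⊕ V ⊗ l) == 0#))  ≡⟨ ∑-cong elements (λ l _ → cong 𝟙 (==-respˡ (constant l))) ⟩
    ∑ elements (λ _ → 𝟙 (U == 0#))            ≡⟨ ∑F-const _ ⟩
    q * 𝟙 (U == 0#)                           ≡⟨ cong (λ b → q * 𝟙 b) (sym (∧-identityʳ _)) ⟩
    q * 𝟙 ((U == 0#) ∧ true)                  ∎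
    where
    open ≡-Reasoning
    constant : ∀ l → U ⊕ V ⊗ l ≈ U
    constant l = ≈-trans (+-congˡ (≈-trans (*-congʳ V≈0) (zeroˡ l))) (+-identityʳ U)
  ... | no V≉0 = begin
    ∑ elements (λ l → 𝟙 ((U ⊕ V ⊗ l) == 0#))  ≡⟨ unique-root U V V≉0 ⟩
    1                                         ≡⟨ cong suc (sym (trans (cong (λ b → q * 𝟙 b) (∧-zeroʳ _)) (ℕ.*-zeroʳ q))) ⟩
    1 + q * 𝟙 ((U == 0#) ∧ false)             ∎
    where open ≡-Reasoning

  Vec : ℕ → Set
  Vec n = Vector Carrier n

  countV : (n : ℕ) → (Vec n → Bool) → ℕ
  countV n P = count P (allVecs n)

  countV-suc : ∀ n (P : Vec (suc n) → Bool) →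
    countV (suc n) P ≡ ∑ elements (λ a → countV n (λ v → P (a ∷ᵥ v)))
  countV-suc n P = trans (count-concatMap P _ elements)
                         (∑-cong elements (λ a _ → count-map P (a ∷ᵥ_) (allVecs n)))

  countV-cong : ∀ n {P Q : Vec n → Bool} → (∀ v → P v ≡ Q v) → countV n P ≡ countV n Q
  countV-cong n P≡Q = count-cong (allVecs n) (λ v _ → P≡Q v)

  countV-const : ∀ n b → countV n (λ _ → b) ≡ 𝟙 b * q ^ n
  countV-const zero    true  = refl
  countV-const zero    false = refl
  countV-const (suc n) b = begin
    countV (suc n) (λ _ → b)                  ≡⟨ countV-suc n _ ⟩
    ∑ elements (λ _ → countV n (λ _ → b))     ≡⟨ ∑-cong elements (λ _ _ → countV-const n b) ⟩
    ∑ elements (λ _ → 𝟙 b * q ^ n)            ≡⟨ ∑F-const _ ⟩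
    q * (𝟙 b * q ^ n)                         ≡⟨ ℕ.*-comm q _ ⟩
    𝟙 b * q ^ n * q                           ≡⟨ ℕ.*-assoc (𝟙 b) _ q ⟩
    𝟙 b * (q ^ n * q)                         ≡⟨ cong (𝟙 b *_) (ℕ.*-comm (q ^ n) q) ⟩
    𝟙 b * q ^ suc n                           ∎
    where open ≡-Reasoning

  dot : (n : ℕ) → Vec n → Vec n → Carrier
  dot zero    u v = 0#
  dot (suc n) u v = head u ⊗ head v ⊕ dot n (tail u) (tail v)

  isZero : (n : ℕ) → Vec n → Bool
  isZero zero    u = true
  isZero (suc n) u = (head u == 0#) ∧ isZero n (tail u)

  isZero-sound : ∀ n u → isZero n u ≡ true → ∀ i → u i ≈ 0#
  isZero-sound (suc n) u u≡0 Fin.zero    = ==-sound (∧-true₁ u≡0)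
  isZero-sound (suc n) u u≡0 (Fin.suc i) = isZero-sound n (tail u) (∧-true₂ u≡0) i

  isZero-complete : ∀ n u → (∀ i → u i ≈ 0#) → isZero n u ≡ true
  isZero-complete zero    u u≈0 = refl
  isZero-complete (suc n) u u≈0 rewrite ==-complete (u≈0 Fin.zero) = isZero-complete n (tail u) (u≈0 ∘ Fin.suc)

  dot-zeroˡ : ∀ n u v → isZero n u ≡ true → dot n u v ≈ 0#
  dot-zeroˡ zero    u v u≡0 = ≈-refl
  dot-zeroˡ (suc n) u v u≡0 = begin
    head u ⊗ head v ⊕ dot n (tail u) (tail v)
      ≈⟨ +-cong (*-congʳ (==-sound (∧-true₁ u≡0))) (dot-zeroˡ n (tail u) (tail v) (∧-true₂ u≡0)) ⟩
    0# ⊗ head v ⊕ 0#   ≈⟨ +-identityʳ _ ⟩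
    0# ⊗ head v        ≈⟨ zeroˡ _ ⟩
    0#                 ∎
    where open ≈-Reasoning

  head-≉0 : ∀ {x} → ((x == 0#) ∧ true) ≡ false → ¬ x ≈ 0#
  head-≉0 x≢0 = ==-false (trans (sym (∧-identityʳ _)) x≢0)

  -- When
  -- a = (a₀, 0, …, 0) the first coordinate is the unique root of c + a₀x and the
  -- others are free; otherwise induct on the tail of a.
  affine-axis : ∀ m (a : Vec (suc m)) c → ¬ head a ≈ 0# → isZero m (tail a) ≡ true →
    countV (suc m) (λ v → (c ⊕ dot (suc m) a v) == 0#) ≡ q ^ m
  affine-axis m a c a₀≉0 tail≡0 = begin
    countV (suc m) (λ v → (c ⊕ dot (suc m) a v) == 0#)
      ≡⟨ countV-suc m _ ⟩
    ∑ elements (λ x → countV m (λ v → (c ⊕ (head a ⊗ x ⊕ dot m (tail a) v)) == 0#))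
      ≡⟨ ∑-cong elements (λ x _ → trans (countV-cong m (λ v → ==-respˡ (first-only x v))) (countV-const m _)) ⟩
    ∑ elements (λ x → 𝟙 ((c ⊕ head a ⊗ x) == 0#) * q ^ m)
      ≡⟨ ∑-*ʳ (q ^ m) _ elements ⟩
    ∑ elements (λ x → 𝟙 ((c ⊕ head a ⊗ x) == 0#)) * q ^ m
      ≡⟨ cong (_* q ^ m) (unique-root c (head a) a₀≉0) ⟩
    1 * q ^ m
      ≡⟨ ℕ.*-identityˡ (q ^ m) ⟩
    q ^ m ∎
    where
    open ≡-Reasoning
    first-only : ∀ x v → c ⊕ (head a ⊗ x ⊕ dot m (tail a) v) ≈ c ⊕ head a ⊗ x
    first-only x v = ≈-trans (≈-sym (+-assoc c _ _)) (≈-trans (+-congˡ (dot-zeroˡ m (tail a) v tail≡0)) (+-identityʳ _))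

  affine-hyperplane : ∀ m (a : Vec (suc m)) c → isZero (suc m) a ≡ false →
    countV (suc m) (λ v → (c ⊕ dot (suc m) a v) == 0#) ≡ q ^ m
  affine-hyperplane zero    a c a≢0 = affine-axis zero a c (head-≉0 a≢0) refl
  affine-hyperplane (suc m) a c a≢0 with isZero (suc m) (tail a) in tail≡0
  ... | true  = affine-axis (suc m) a c (head-≉0 a≢0) tail≡0
  ... | false = begin
    countV (suc (suc m)) (λ v → (c ⊕ dot (suc (suc m)) a v) == 0#)
      ≡⟨ countV-suc (suc m) _ ⟩
    ∑ elements (λ x → countV (suc m) (λ v → (c ⊕ (head a ⊗ x ⊕ dot (suc m) (tail a) v)) == 0#))
      ≡⟨ ∑-cong elements (λ x _ → trans (countV-cong (suc m) (λ v → ==-respˡ (≈-sym (+-assoc c _ _))))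
                                        (affine-hyperplane m (tail a) (c ⊕ head a ⊗ x) tail≡0)) ⟩
    ∑ elements (λ _ → q ^ m)
      ≡⟨ ∑F-const (q ^ m) ⟩
    q ^ suc m ∎
    where open ≡-Reasoning

  countN : (n : ℕ) → (Vec n → Bool) → ℕ
  countN n P = countV n (λ v → isNormalised n v ∧ P v)

  countN-cong : ∀ n {P Q : Vec n → Bool} → (∀ v → isNormalised n v ≡ true → P v ≡ Q v) →
    countN n P ≡ countN n Q
  countN-cong n {P} {Q} P≡Q = countV-cong n agree
    where
    agree : ∀ v → (isNormalised n v ∧ P v) ≡ (isNormalised n v ∧ Q v)
    agree v with isNormalised n v in normal
    ... | true  = P≡Q v normal
    ... | false = refl

  -- A normalised vector of F^(n+1) has first coordinate 0 followed by a normalised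
  -- vector, or first coordinate 1 followed by an arbitrary vector.
  countN-suc : ∀ n (P : Vec (suc n) → Bool) → (∀ a b v → a ≈ b → P (a ∷ᵥ v) ≡ P (b ∷ᵥ v)) →
    countN (suc n) P ≡ countN n (λ v → P (0# ∷ᵥ v)) + countV n (λ v → P (1# ∷ᵥ v))
  countN-suc n P P-resp = begin
    countN (suc n) P
      ≡⟨ countV-suc n _ ⟩
    ∑ elements (λ a → countV n (λ v → isNormalised (suc n) (a ∷ᵥ v) ∧ P (a ∷ᵥ v)))
      ≡⟨ ∑-cong elements (λ a _ → by-head a) ⟩
    ∑ elements (λ a → (if a == 0# then N₀ else 0) + (if a == 1# then N₁ else 0))
      ≡⟨ ∑-+ _ _ elements ⟩
    ∑ elements (λ a → if a == 0# then N₀ else 0) + ∑ elements (λ a → if a == 1# then N₁ else 0)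
      ≡⟨ cong₂ _+_ (∑F-delta 0# N₀) (∑F-delta 1# N₁) ⟩
    N₀ + N₁ ∎
    where
    open ≡-Reasoning
    N₀ N₁ : ℕ
    N₀ = countN n (λ v → P (0# ∷ᵥ v))
    N₁ = countV n (λ v → P (1# ∷ᵥ v))
    by-head : ∀ a → countV n (λ v → isNormalised (suc n) (a ∷ᵥ v) ∧ P (a ∷ᵥ v)) ≡
                    (if a == 0# then N₀ else 0) + (if a == 1# then N₁ else 0)
    by-head a with a ≟ 0#
    ... | yes a≈0 = trans (countV-cong n (λ v → cong (isNormalised n v ∧_) (P-resp a 0# v a≈0)))
                          (sym (trans (cong (λ b → N₀ + (if b then N₁ else 0)) (==-refute a≉1)) (ℕ.+-identityʳ N₀)))
      where
      a≉1 : ¬ a ≈ 1#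
      a≉1 a≈1 = 0≉1 (≈-trans (≈-sym a≈0) a≈1)
    ... | no _ with a ≟ 1#
    ...   | yes a≈1 = countV-cong n (λ v → P-resp a 1# v a≈1)
    ...   | no _    = countV-const n false

  countN-all : ∀ n → countN n (λ _ → true) ≡ θ q n
  countN-all zero    = refl
  countN-all (suc n) = trans (countN-suc n (λ _ → true) (λ _ _ _ _ → refl))
                             (cong₂ _+_ (countN-all n) (trans (countV-const n true) (ℕ.*-identityˡ (q ^ n))))

  dot-resp-head : ∀ m (a : Vec (suc m)) x y v → x ≈ y →
    (dot (suc m) a (x ∷ᵥ v) == 0#) ≡ (dot (suc m) a (y ∷ᵥ v) == 0#)
  dot-resp-head m a x y v x≈y = ==-respˡ (+-congʳ (*-congˡ x≈y))

  -- A normalised vector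
  -- (0, v) lies on it iff v lies on the hyperplane (tail a)·v = 0 of PG(m-1,q), and a
  -- vector (1, v) iff v lies on the affine hyperplane a₀ + (tail a)·v = 0.  When
  -- tail a = 0 these are all θ m points of PG(m-1,q), and no vector at all.
  hyperplane-axis : ∀ m (a : Vec (suc m)) → ¬ head a ≈ 0# → isZero m (tail a) ≡ true →
    countN (suc m) (λ v → dot (suc m) a v == 0#) ≡ θ q m
  hyperplane-axis m a a₀≉0 tail≡0 = begin
    countN (suc m) (λ v → dot (suc m) a v == 0#)
      ≡⟨ countN-suc m _ (dot-resp-head m a) ⟩
    countN m (λ v → (head a ⊗ 0# ⊕ dot m (tail a) v) == 0#) + countV m (λ v → (head a ⊗ 1# ⊕ dot m (tail a) v) == 0#)
      ≡⟨ cong₂ _+_ (trans (countN-cong m (λ v _ → ==-complete (on-hyperplane v))) (countN-all m))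
                   (trans (countV-cong m (λ v → ==-refute (off-hyperplane v))) (countV-const m false)) ⟩
    θ q m + 0
      ≡⟨ ℕ.+-identityʳ (θ q m) ⟩
    θ q m ∎
    where
    open ≡-Reasoning
    tail-vanishes : ∀ x v → x ⊕ dot m (tail a) v ≈ x
    tail-vanishes x v = ≈-trans (+-congˡ (dot-zeroˡ m (tail a) v tail≡0)) (+-identityʳ x)
    on-hyperplane : ∀ v → head a ⊗ 0# ⊕ dot m (tail a) v ≈ 0#
    on-hyperplane v = ≈-trans (tail-vanishes _ v) (zeroʳ (head a))
    off-hyperplane : ∀ v → ¬ head a ⊗ 1# ⊕ dot m (tail a) v ≈ 0#
    off-hyperplane v a₀≈0 = a₀≉0 (≈-trans (≈-sym (≈-trans (tail-vanishes _ v) (*-identityʳ (head a)))) a₀≈0)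

  hyperplane : ∀ m (a : Vec (suc m)) → isZero (suc m) a ≡ false →
    countN (suc m) (λ v → dot (suc m) a v == 0#) ≡ θ q m
  hyperplane zero    a a≢0 = hyperplane-axis zero a (head-≉0 a≢0) refl
  hyperplane (suc m) a a≢0 with isZero (suc m) (tail a) in tail≡0
  ... | true  = hyperplane-axis (suc m) a (head-≉0 a≢0) tail≡0
  ... | false = begin
    countN (suc (suc m)) (λ v → dot (suc (suc m)) a v == 0#)
      ≡⟨ countN-suc (suc m) _ (dot-resp-head (suc m) a) ⟩
    countN (suc m) (λ v → (head a ⊗ 0# ⊕ dot (suc m) (tail a) v) == 0#)
      + countV (suc m) (λ v → (head a ⊗ 1# ⊕ dot (suc m) (tail a) v) == 0#)
      ≡⟨ cong₂ _+_ (trans (countN-cong (suc m) (λ v _ → ==-respˡ (drop-head v))) (hyperplane m (tail a) tail≡0))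
                   (affine-hyperplane m (tail a) (head a ⊗ 1#) tail≡0) ⟩
    θ q m + q ^ m ∎
    where
    open ≡-Reasoning
    drop-head : ∀ v → head a ⊗ 0# ⊕ dot (suc m) (tail a) v ≈ dot (suc m) (tail a) v
    drop-head v = ≈-trans (+-congʳ (zeroʳ (head a))) (+-identityˡ _)

  sameVec : (n : ℕ) → Vec n → Vec n → Bool
  sameVec zero    u v = true
  sameVec (suc n) u v = (head u == head v) ∧ sameVec n (tail u) (tail v)

  sameVec-sound : ∀ n u v → sameVec n u v ≡ true → ∀ i → u i ≈ v i
  sameVec-sound (suc n) u v u≡v Fin.zero    = ==-sound (∧-true₁ u≡v)
  sameVec-sound (suc n) u v u≡v (Fin.suc i) = sameVec-sound n (tail u) (tail v) (∧-true₂ u≡v) i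

  sameVec-complete : ∀ n u v → (∀ i → u i ≈ v i) → sameVec n u v ≡ true
  sameVec-complete zero    u v u≈v = refl
  sameVec-complete (suc n) u v u≈v rewrite ==-complete (u≈v Fin.zero) =
    sameVec-complete n (tail u) (tail v) (u≈v ∘ Fin.suc)

  countV-sameVec : ∀ n u → countV n (sameVec n u) ≡ 1
  countV-sameVec zero    u = refl
  countV-sameVec (suc n) u = trans (countV-suc n _) (trans (∑-cong elements (λ a _ → by-head a)) (∑F-delta (head u) 1))
    where
    by-head : ∀ a → countV n (λ v → (head u == a) ∧ sameVec n (tail u) v) ≡ 𝟙 (a == head u)
    by-head a rewrite ==-iff {head u} {a} ≈-sym ≈-sym with a == head u
    ... | true  = countV-sameVec n (tail u)
    ... | false = countV-const n false

  isNormalised-resp : ∀ n u v → (∀ i → u i ≈ v i) → isNormalised n u ≡ isNormalised n v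
  isNormalised-resp zero    u v u≈v = refl
  isNormalised-resp (suc n) u v u≈v
    rewrite ==-respˡ {z = 0#} (u≈v Fin.zero) | ==-respˡ {z = 1#} (u≈v Fin.zero)
          | isNormalised-resp n (tail u) (tail v) (u≈v ∘ Fin.suc) = refl

  dot-respˡ : ∀ n u v x → (∀ i → u i ≈ v i) → dot n u x ≈ dot n v x
  dot-respˡ zero    u v x u≈v = ≈-refl
  dot-respˡ (suc n) u v x u≈v = +-cong (*-congʳ (u≈v Fin.zero)) (dot-respˡ n (tail u) (tail v) (tail x) (u≈v ∘ Fin.suc))

  normalised-nonzero : ∀ n u → isNormalised n u ≡ true → isZero n u ≡ false
  normalised-nonzero (suc n) u normal with head u ≟ 0#
  ... | yes _ = normalised-nonzero n (tail u) normal
  ... | no _  = refl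

  normalised-tail : ∀ n u → head u ≈ 0# → isNormalised (suc n) u ≡ true → isNormalised n (tail u) ≡ true
  normalised-tail n u u₀≈0 normal with head u ≟ 0#
  ... | yes _    = normal
  ... | no u₀≉0 = ⊥-elim (u₀≉0 u₀≈0)

  proportional⇒equal : ∀ n u v c → isNormalised n u ≡ true → isNormalised n v ≡ true →
    (∀ i → u i ≈ c ⊗ v i) → ∀ i → u i ≈ v i
  proportional⇒equal (suc n) u v c u-normal v-normal u≈cv with head v ≟ 0#
  ... | yes v₀≈0 = λ
    { Fin.zero    → ≈-trans u₀≈0 (≈-sym v₀≈0)
    ; (Fin.suc i) → proportional⇒equal n (tail u) (tail v) c (normalised-tail n u u₀≈0 u-normal)
                      v-normal (u≈cv ∘ Fin.suc) i }
    where
    u₀≈0 : head u ≈ 0#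
    u₀≈0 = ≈-trans (u≈cv Fin.zero) (≈-trans (*-congˡ v₀≈0) (zeroʳ c))
  ... | no v₀≉0 with head u ≟ 0#
  ...   | yes u₀≈0 = ⊥-elim (true≢false (sym (trans (sym (normalised-nonzero n (tail u) u-normal))
                                              (isZero-complete n (tail u) (u≈0 ∘ Fin.suc)))))
    where
    c≈0 : c ≈ 0#
    c≈0 = ≈-trans (≈-sym (≈-trans (*-congˡ (==-sound v-normal)) (*-identityʳ c)))
                  (≈-trans (≈-sym (u≈cv Fin.zero)) u₀≈0)
    u≈0 : ∀ i → u i ≈ 0#
    u≈0 i = ≈-trans (u≈cv i) (≈-trans (*-congʳ c≈0) (zeroˡ (v i)))
  ...   | no u₀≉0 = λ i → ≈-trans (u≈cv i) (≈-trans (*-congʳ c≈1) (*-identityˡ (v i)))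
    where
    c≈1 : c ≈ 1#
    c≈1 = begin
      c           ≈⟨ ≈-sym (*-identityʳ c) ⟩
      c ⊗ 1#      ≈⟨ *-congˡ (≈-sym (==-sound v-normal)) ⟩
      c ⊗ head v  ≈⟨ ≈-sym (u≈cv Fin.zero) ⟩
      head u      ≈⟨ ==-sound u-normal ⟩
      1#          ∎
      where open ≈-Reasoning

  combine : ∀ {n} → Vec n → Vec n → Carrier → Vec n
  combine u v l i = u i ⊕ l ⊗ v i

  dot-combine : ∀ n u v l x → dot n (combine u v l) x ≈ dot n u x ⊕ l ⊗ dot n v x
  dot-combine zero    u v l x = ≈-sym (≈-trans (+-congˡ (zeroʳ l)) (+-identityʳ 0#))
  dot-combine (suc n) u v l x = begin
    (u₀ ⊕ l ⊗ v₀) ⊗ x₀ ⊕ dot n (combine (tail u) (tail v) l) (tail x)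
      ≈⟨ +-cong (≈-trans (distribʳ x₀ u₀ (l ⊗ v₀)) (+-congˡ (*-assoc l v₀ x₀)))
                (dot-combine n (tail u) (tail v) l (tail x)) ⟩
    (u₀ ⊗ x₀ ⊕ l ⊗ (v₀ ⊗ x₀)) ⊕ (dot n (tail u) (tail x) ⊕ l ⊗ dot n (tail v) (tail x))
      ≈⟨ interchange _ _ _ _ ⟩
    (u₀ ⊗ x₀ ⊕ dot n (tail u) (tail x)) ⊕ (l ⊗ (v₀ ⊗ x₀) ⊕ l ⊗ dot n (tail v) (tail x))
      ≈⟨ +-congˡ (≈-sym (distribˡ l _ _)) ⟩
    (u₀ ⊗ x₀ ⊕ dot n (tail u) (tail x)) ⊕ l ⊗ (v₀ ⊗ x₀ ⊕ dot n (tail v) (tail x)) ∎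
    where
    open ≈-Reasoning
    u₀ v₀ x₀ : Carrier
    u₀ = head u
    v₀ = head v
    x₀ = head x

  combine-nonzero : ∀ n u v l → isNormalised n u ≡ true → isNormalised n v ≡ true → sameVec n u v ≡ false →
    isZero n (combine u v l) ≡ false
  combine-nonzero n u v l u-normal v-normal u≢v with isZero n (combine u v l) in u+lv≡0
  ... | false = refl
  ... | true  = ⊥-elim (true≢false (trans (sym (sameVec-complete n u v u≈v)) u≢v))
    where
    u≈-lv : ∀ i → u i ≈ ⊖ l ⊗ v i
    u≈-lv i = ≈-trans (inverseˡ-unique (u i) (l ⊗ v i) (isZero-sound n _ u+lv≡0 i)) (-‿distribˡ-* l (v i))
    u≈v : ∀ i → u i ≈ v i
    u≈v = proportional⇒equal n u v (⊖ l) u-normal v-normal u≈-lv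

  hyperplane-complement : ∀ m (a : Vec (suc m)) → isZero (suc m) a ≡ false →
    countN (suc m) (λ x → not (dot (suc m) a x == 0#)) ≡ q ^ m
  hyperplane-complement m a a≢0 = ℕ.+-cancelˡ-≡ (θ q m) _ _ (begin
    θ q m + off          ≡⟨ ℕ.+-comm (θ q m) off ⟩
    off + θ q m          ≡⟨ cong (off +_) (sym (hyperplane m a a≢0)) ⟩
    off + on             ≡⟨ count-split (isNormalised (suc m)) (λ x → dot (suc m) a x == 0#) (allVecs (suc m)) ⟩
    countV (suc m) (isNormalised (suc m))
                         ≡⟨ countV-cong (suc m) (λ x → sym (∧-identityʳ _)) ⟩
    countN (suc m) (λ _ → true)
                         ≡⟨ countN-all (suc m) ⟩
    θ q m + q ^ m        ∎)
    where
    open ≡-Reasoning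
    on off : ℕ
    on  = countN (suc m) (λ x → dot (suc m) a x == 0#)
    off = countN (suc m) (λ x → not (dot (suc m) a x == 0#))

  -- Double count the pairs (l, x) with x on the hyperplane (u + l·v)·x = 0: each of these
  -- q hyperplanes has θ (m+1) points, while a point x lies on exactly one of them if
  -- v·x ≠ 0 and on all of them if u·x = v·x = 0.
  two-hyperplanes : ∀ m (u v : Vec (suc (suc m))) →
    isNormalised (suc (suc m)) u ≡ true → isNormalised (suc (suc m)) v ≡ true → sameVec (suc (suc m)) u v ≡ false →
    countN (suc (suc m)) (λ x → (dot (suc (suc m)) u x == 0#) ∧ (dot (suc (suc m)) v x == 0#)) ≡ θ q m
  two-hyperplanes m u v u-normal v-normal u≢v = ℕ.*-cancelˡ-≡ _ _ q {{q-nonZero}} (ℕ.+-cancelˡ-≡ (q ^ suc m) _ _ (begin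
    q ^ suc m + q * meet        ≡⟨ sym by-points ⟩
    pairs                       ≡⟨ by-hyperplanes ⟩
    q * (θ q m + q ^ m)         ≡⟨ ℕ.*-distribˡ-+ q (θ q m) (q ^ m) ⟩
    q * θ q m + q ^ suc m       ≡⟨ ℕ.+-comm (q * θ q m) _ ⟩
    q ^ suc m + q * θ q m       ∎))
    where
    open ≡-Reasoning
    n : ℕ
    n = suc (suc m)
    meet : ℕ
    meet = countN n (λ x → (dot n u x == 0#) ∧ (dot n v x == 0#))
    on : Carrier → Vec n → Bool
    on l x = isNormalised n x ∧ (dot n (combine u v l) x == 0#)
    pairs : ℕ
    pairs = ∑ elements (λ l → countV n (on l))
    by-hyperplanes : pairs ≡ q * θ q (suc m)
    by-hyperplanes = trans (∑-cong elements (λ l _ → hyperplane (suc m) (combine u v l) (combine-nonzero n u v l u-normal v-normal u≢v)))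
                     (∑F-const _)
    hyperplanes-through : ∀ x → ∑ elements (λ l → 𝟙 (on l x)) ≡
      𝟙 (isNormalised n x ∧ not (dot n v x == 0#)) + q * 𝟙 (isNormalised n x ∧ ((dot n u x == 0#) ∧ (dot n v x == 0#)))
    hyperplanes-through x with isNormalised n x
    ... | false = ∑F-const 0
    ... | true  = trans (∑-cong elements (λ l _ → cong 𝟙 (==-respˡ (≈-trans (dot-combine n u v l x) (+-congˡ (*-comm l _))))))
                        (root-count (dot n u x) (dot n v x))
    by-points : pairs ≡ q ^ suc m + q * meet
    by-points = begin
      pairs
        ≡⟨ ∑-cong elements (λ l _ → count≡∑𝟙 (on l) (allVecs n)) ⟩
      ∑ elements (λ l → ∑ (allVecs n) (λ x → 𝟙 (on l x)))
        ≡⟨ ∑-swap (λ l x → 𝟙 (on l x)) elements (allVecs n) ⟩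
      ∑ (allVecs n) (λ x → ∑ elements (λ l → 𝟙 (on l x)))
        ≡⟨ ∑-cong (allVecs n) (λ x _ → hyperplanes-through x) ⟩
      ∑ (allVecs n) (λ x → 𝟙 (isNormalised n x ∧ not (dot n v x == 0#)) + q * 𝟙 (isNormalised n x ∧ ((dot n u x == 0#) ∧ (dot n v x == 0#))))
        ≡⟨ trans (∑-+ _ _ (allVecs n)) (cong₂ _+_ (sym (count≡∑𝟙 _ (allVecs n)))
                                                 (trans (∑-*ˡ q _ (allVecs n)) (cong (q *_) (sym (count≡∑𝟙 _ (allVecs n)))))) ⟩
      countN n (λ x → not (dot n v x == 0#)) + q * meet
        ≡⟨ cong (_+ q * meet) (hyperplane-complement (suc m) v (normalised-nonzero n v v-normal)) ⟩
      q ^ suc m + q * meet ∎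


module Incidence {q : ℕ} (F : FiniteField q) where
  open FiniteField F using () renaming (refl to ≈-refl; sym to ≈-sym)
  open PG F using (V5; points; onSolid; allVecs; isNormalised)
  open LinearCounting F

  count-points : ∀ P → count P points ≡ countN 5 P
  count-points P = count-filter P (isNormalised 5) (allVecs 5)

  point-normalised : ∀ {u} → u ∈ points → isNormalised 5 u ≡ true
  point-normalised u∈points = Equivalence.to T-≡ (proj₂ (∈-filter⁻ (T? ∘ isNormalised 5) {xs = allVecs 5} u∈points))

  #points : count (λ _ → true) points ≡ θ q 5
  #points = trans (count-points _) (countN-all 5)

  solid-size : ∀ {u} → u ∈ points → count (λ x → onSolid x u) points ≡ θ q 4
  solid-size {u} u∈points =
    trans (count-points _) (hyperplane 4 u (normalised-nonzero 5 u (point-normalised u∈points)))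

  solid-meet : ∀ {u v} → u ∈ points → v ∈ points →
    count (λ x → onSolid x u ∧ onSolid x v) points ≡ θ q 3 + q ^ 3 * 𝟙 (sameVec 5 u v)
  solid-meet {u} {v} u∈points v∈points with sameVec 5 u v in u≡v
  ... | true = begin
    count (λ x → onSolid x u ∧ onSolid x v) points  ≡⟨ count-cong points (λ x _ → v-redundant x) ⟩
    count (λ x → onSolid x u) points                ≡⟨ solid-size u∈points ⟩
    θ q 3 + q ^ 3                                   ≡⟨ cong (θ q 3 +_) (ℕ.*-identityʳ (q ^ 3)) ⟨
    θ q 3 + q ^ 3 * 1                               ∎
    where
    open ≡-Reasoning
    v-redundant : ∀ x → (onSolid x u ∧ onSolid x v) ≡ onSolid x u
    v-redundant x = trans (cong (onSolid x u ∧_) (==-respˡ (dot-respˡ 5 v u x (≈-sym ∘ sameVec-sound 5 u v u≡v))))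
                          (∧-idem (onSolid x u))
  ... | false = begin
    count (λ x → onSolid x u ∧ onSolid x v) points  ≡⟨ count-points _ ⟩
    countN 5 (λ x → onSolid x u ∧ onSolid x v)      ≡⟨ two-hyperplanes 3 u v (point-normalised u∈points) (point-normalised v∈points) u≡v ⟩
    θ q 3                                           ≡⟨ ℕ.+-identityʳ (θ q 3) ⟨
    θ q 3 + 0                                       ≡⟨ cong (θ q 3 +_) (ℕ.*-zeroʳ (q ^ 3)) ⟨
    θ q 3 + q ^ 3 * 0                               ∎
    where open ≡-Reasoning

  sameVec-unique : ∀ {u} → u ∈ points → count (sameVec 5 u) points ≡ 1
  sameVec-unique {u} u∈points = trans (count-points _) (trans (countV-cong 5 normal-if-same) (countV-sameVec 5 u))
    where
    normal-if-same : ∀ v → (isNormalised 5 v ∧ sameVec 5 u v) ≡ sameVec 5 u v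
    normal-if-same v with sameVec 5 u v in u≡v
    ... | true  = trans (cong (_∧ true) (trans (isNormalised-resp 5 v u (≈-sym ∘ sameVec-sound 5 u v u≡v))
                                               (point-normalised u∈points)))
                        refl
    ... | false = ∧-zeroʳ _

  module DoubleCounting (E : V5 → Bool) where
    open PG F using (pointDeg; sizeE)

    χ : V5 → V5 → ℕ
    χ u x = 𝟙 (E u ∧ onSolid x u)

    degree-∑ : ∀ x → pointDeg E x ≡ ∑ points (λ u → χ u x)
    degree-∑ x = count≡∑𝟙 _ points

    solid-incidences : ∀ {u} → u ∈ points → ∑ points (χ u) ≡ 𝟙 (E u) * θ q 4
    solid-incidences {u} u∈points with E u
    ... | true  = trans (sym (count≡∑𝟙 _ points)) (trans (solid-size u∈points) (sym (ℕ.*-identityˡ (θ q 4))))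
    ... | false = ∑-zero points

    first-moment : ∑ points (pointDeg E) ≡ sizeE E * θ q 4
    first-moment = begin
      ∑ points (pointDeg E)                    ≡⟨ ∑-cong points (λ x _ → degree-∑ x) ⟩
      ∑ points (λ x → ∑ points (λ u → χ u x))  ≡⟨ ∑-swap (λ x u → χ u x) points points ⟩
      ∑ points (λ u → ∑ points (χ u))          ≡⟨ ∑-cong points (λ u u∈points → solid-incidences u∈points) ⟩
      ∑ points (λ u → 𝟙 (E u) * θ q 4)         ≡⟨ ∑-𝟙-* E (θ q 4) points ⟩
      sizeE E * θ q 4                          ∎
      where open ≡-Reasoning

    pair-incidences : ∀ {u v} → u ∈ points → v ∈ points →
      ∑ points (λ x → 𝟙 (onSolid x u) * χ v x) ≡ 𝟙 (E v) * (θ q 3 + q ^ 3 * 𝟙 (sameVec 5 u v))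
    pair-incidences {u} {v} u∈points v∈points with E v
    ... | true  = begin
      ∑ points (λ x → 𝟙 (onSolid x u) * 𝟙 (onSolid x v))  ≡⟨ ∑-cong points (λ x _ → 𝟙-∧ (onSolid x u) (onSolid x v)) ⟩
      ∑ points (λ x → 𝟙 (onSolid x u ∧ onSolid x v))      ≡⟨ count≡∑𝟙 _ points ⟨
      count (λ x → onSolid x u ∧ onSolid x v) points      ≡⟨ solid-meet u∈points v∈points ⟩
      θ q 3 + q ^ 3 * 𝟙 (sameVec 5 u v)                   ≡⟨ ℕ.*-identityˡ _ ⟨
      1 * (θ q 3 + q ^ 3 * 𝟙 (sameVec 5 u v))             ∎
      where open ≡-Reasoning
    ... | false = trans (∑-cong points (λ x _ → ℕ.*-zeroʳ (𝟙 (onSolid x u)))) (∑-zero points)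

    -- For a solid u of E, the sizes of its meets with the solids of E add up to
    -- θ 3 |E| + q³: each meet has θ 3 points, except the meet of u with itself.
    solid-pairs : ∀ {u} → u ∈ points →
      ∑ points (λ v → ∑ points (λ x → χ u x * χ v x)) ≡ 𝟙 (E u) * (θ q 3 * sizeE E + q ^ 3)
    solid-pairs {u} u∈points with E u in u∈E
    ... | false = trans (∑-cong points (λ v _ → ∑-zero points)) (∑-zero points)
    ... | true  = begin
      ∑ points (λ v → ∑ points (λ x → 𝟙 (onSolid x u) * χ v x))
        ≡⟨ ∑-cong points (λ v v∈points → pair-incidences u∈points v∈points) ⟩
      ∑ points (λ v → 𝟙 (E v) * (θ q 3 + q ^ 3 * 𝟙 (sameVec 5 u v)))
        ≡⟨ ∑-cong points (λ v _ → spread (E v) (sameVec 5 u v)) ⟩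
      ∑ points (λ v → θ q 3 * 𝟙 (E v) + q ^ 3 * 𝟙 (E v ∧ sameVec 5 u v))
        ≡⟨ ∑-+ _ _ points ⟩
      ∑ points (λ v → θ q 3 * 𝟙 (E v)) + ∑ points (λ v → q ^ 3 * 𝟙 (E v ∧ sameVec 5 u v))
        ≡⟨ cong₂ _+_ (trans (∑-*ˡ (θ q 3) _ points) (cong (θ q 3 *_) (sym (count≡∑𝟙 E points))))
                     (trans (∑-*ˡ (q ^ 3) _ points) (cong (q ^ 3 *_) (trans (sym (count≡∑𝟙 _ points)) only-u))) ⟩
      θ q 3 * sizeE E + q ^ 3 * 1
        ≡⟨ trans (cong (θ q 3 * sizeE E +_) (ℕ.*-identityʳ (q ^ 3))) (sym (ℕ.*-identityˡ _)) ⟩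
      1 * (θ q 3 * sizeE E + q ^ 3) ∎
      where
      open ≡-Reasoning
      spread : ∀ a c → 𝟙 a * (θ q 3 + q ^ 3 * 𝟙 c) ≡ θ q 3 * 𝟙 a + q ^ 3 * 𝟙 (a ∧ c)
      spread true  c = trans (ℕ.*-identityˡ _) (cong (_+ q ^ 3 * 𝟙 c) (sym (ℕ.*-identityʳ (θ q 3))))
      spread false c = sym (cong₂ _+_ (ℕ.*-zeroʳ (θ q 3)) (ℕ.*-zeroʳ (q ^ 3)))
      only-u : count (λ v → E v ∧ sameVec 5 u v) points ≡ 1
      only-u = trans (count-∧-singleton E (sameVec 5 u) points u u∈points
                                        (sameVec-complete 5 u u (λ _ → ≈-refl)) (sameVec-unique u∈points))
                     (cong 𝟙 u∈E)

    -- ∑ₓ deg(x)² counts the triples (u, v, x) with x on the solids u, v of E.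
    second-moment : ∑ points (λ x → pointDeg E x * pointDeg E x) ≡ sizeE E * (θ q 3 * sizeE E + q ^ 3)
    second-moment = begin
      ∑ points (λ x → pointDeg E x * pointDeg E x)
        ≡⟨ ∑-cong points (λ x _ → trans (cong₂ _*_ (degree-∑ x) (degree-∑ x)) (∑-square (λ u → χ u x) points)) ⟩
      ∑ points (λ x → ∑ points (λ u → ∑ points (λ v → χ u x * χ v x)))
        ≡⟨ ∑-swap (λ x u → ∑ points (λ v → χ u x * χ v x)) points points ⟩
      ∑ points (λ u → ∑ points (λ x → ∑ points (λ v → χ u x * χ v x)))
        ≡⟨ ∑-cong points (λ u _ → ∑-swap (λ x v → χ u x * χ v x) points points) ⟩
      ∑ points (λ u → ∑ points (λ v → ∑ points (λ x → χ u x * χ v x)))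
        ≡⟨ ∑-cong points (λ u u∈points → solid-pairs u∈points) ⟩
      ∑ points (λ u → 𝟙 (E u) * (θ q 3 * sizeE E + q ^ 3))
        ≡⟨ ∑-𝟙-* E _ points ⟩
      sizeE E * (θ q 3 * sizeE E + q ^ 3) ∎
      where open ≡-Reasoning


θ-4 : ∀ q → θ q 4 ≡ q ^ 3 + q ^ 2 + q + 1
θ-4 = solve 1 (λ q → con 1 :+ q :^ 1 :+ q :^ 2 :+ q :^ 3 := q :^ 3 :+ q :^ 2 :+ q :+ con 1) refl

-- A function with values in {0, b + d, b} (b, d ≠ 0) has its two nonzero level
-- counts x, y determined by its first two moments: eliminating x from the two
-- equations leaves d·b·y.
two-moments-determine : ∀ b d {x y x₀ y₀} → .{{NonZero b}} → .{{NonZero d}} →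
  (b + d) * x + b * y ≡ (b + d) * x₀ + b * y₀ →
  (b + d) * (b + d) * x + b * b * y ≡ (b + d) * (b + d) * x₀ + b * b * y₀ →
  x ≡ x₀ × y ≡ y₀
two-moments-determine b d {x} {y} {x₀} {y₀} first second = x≡x₀ , y≡y₀
  where
  open ≡-Reasoning
  expand : ∀ b d x y → (b + d) * ((b + d) * x + b * y) ≡ ((b + d) * (b + d) * x + b * b * y) + d * b * y
  expand = solve-∀
  eliminate : ∀ x y → (b + d) * ((b + d) * x + b * y) ≡ ((b + d) * (b + d) * x + b * b * y) + d * b * y
  eliminate = expand b d
  y≡y₀ : y ≡ y₀
  y≡y₀ = ℕ.*-cancelˡ-≡ y y₀ (d * b) {{ℕ.m*n≢0 d b}} (ℕ.+-cancelˡ-≡ _ _ _ (begin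
    ((b + d) * (b + d) * x₀ + b * b * y₀) + d * b * y  ≡⟨ cong (_+ d * b * y) second ⟨
    ((b + d) * (b + d) * x + b * b * y) + d * b * y    ≡⟨ eliminate x y ⟨
    (b + d) * ((b + d) * x + b * y)                    ≡⟨ cong ((b + d) *_) first ⟩
    (b + d) * ((b + d) * x₀ + b * y₀)                  ≡⟨ eliminate x₀ y₀ ⟩
    ((b + d) * (b + d) * x₀ + b * b * y₀) + d * b * y₀ ∎))
  x≡x₀ : x ≡ x₀
  x≡x₀ = ℕ.*-cancelˡ-≡ x x₀ (b + d) {{>-nonZero (ℕ.<-≤-trans (>-nonZero⁻¹ b) (ℕ.m≤m+n b d))}}
           (ℕ.+-cancelʳ-≡ (b * y₀) _ _ (trans (cong (λ t → (b + d) * x + b * t) (sym y≡y₀)) first))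

kᴾ qᴾ pᴾ θ₃ᴾ θ₄ᴾ : Polynomial 1 → Polynomial 1
kᴾ m  = con 1 :+ m
qᴾ m  = con 2 :* kᴾ m
pᴾ m  = con 1 :+ con 2 :* m
θ₃ᴾ m = con 1 :+ qᴾ m :^ 1 :+ qᴾ m :^ 2
θ₄ᴾ m = θ₃ᴾ m :+ qᴾ m :^ 3

module Parameters (m : ℕ) where

  k q p : ℕ
  k = suc m
  q = 2 * k
  p = 1 + 2 * m

  white black size : ℕ
  white = k * q ^ 2
  black = k * q ^ 2 ∸ k * q
  size  = k * q * (q ^ 2 ∸ 1)

  -- Subtraction-free forms: black = b, white = b + d, size = d (q² - 1).
  b d : ℕ
  b = k * q * p
  d = k * q

  white≡ : white ≡ b + d
  white≡ = solve 1 (λ m → kᴾ m :* qᴾ m :^ 2 := kᴾ m :* qᴾ m :* pᴾ m :+ kᴾ m :* qᴾ m) refl m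

  black≡ : black ≡ b
  black≡ = trans (cong (_∸ d) white≡) (ℕ.m+n∸n≡m b d)

  q²-1≡ : q ^ 2 ∸ 1 ≡ p * (q + 1)
  q²-1≡ = trans (cong (_∸ 1) q²≡) (ℕ.m+n∸n≡m _ 1)
    where
    q²≡ : q ^ 2 ≡ p * (q + 1) + 1
    q²≡ = solve 1 (λ m → qᴾ m :^ 2 := pᴾ m :* (qᴾ m :+ con 1) :+ con 1) refl m

  q⁴-1≡ : q ^ 4 ∸ 1 ≡ p * θ q 4
  q⁴-1≡ = trans (cong (_∸ 1) q⁴≡) (ℕ.m+n∸n≡m _ 1)
    where
    q⁴≡ : q ^ 4 ≡ p * θ q 4 + 1
    q⁴≡ = solve 1 (λ m → qᴾ m :^ 4 := pᴾ m :* θ₄ᴾ m :+ con 1) refl m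

  θ₅≡ : θ q 5 ≡ 1 + p * θ q 4 + θ q 4
  θ₅≡ = solve 1 (λ m → θ₄ᴾ m :+ qᴾ m :^ 4 := con 1 :+ pᴾ m :* θ₄ᴾ m :+ θ₄ᴾ m) refl m

  size≡ : size ≡ d * (p * (q + 1))
  size≡ = cong (d *_) q²-1≡

  first-identity : (b + d) * (p * θ q 4) + b * θ q 4 ≡ d * (p * (q + 1)) * θ q 4
  first-identity = solve 1 (λ m → let B = kᴾ m :* qᴾ m :* pᴾ m ; D = kᴾ m :* qᴾ m in
    (B :+ D) :* (pᴾ m :* θ₄ᴾ m) :+ B :* θ₄ᴾ m := D :* (pᴾ m :* (qᴾ m :+ con 1)) :* θ₄ᴾ m) refl m

  second-identity : (b + d) * (b + d) * (p * θ q 4) + b * b * θ q 4 ≡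
                    d * (p * (q + 1)) * (θ q 3 * (d * (p * (q + 1))) + q ^ 3)
  second-identity = solve 1 (λ m → let B = kᴾ m :* qᴾ m :* pᴾ m ; D = kᴾ m :* qᴾ m ; S = D :* (pᴾ m :* (qᴾ m :+ con 1)) in
    (B :+ D) :* (B :+ D) :* (pᴾ m :* θ₄ᴾ m) :+ B :* B :* θ₄ᴾ m := S :* (θ₃ᴾ m :* S :+ qᴾ m :^ 3)) refl m

  level-counts : ∀ {c₀ cw cb} → c₀ + cw + cb ≡ θ q 5 →
    white * cw + black * cb ≡ size * θ q 4 →
    white * white * cw + black * black * cb ≡ size * (θ q 3 * size + q ^ 3) →
    cb ≡ θ q 4 × cw ≡ q ^ 4 ∸ 1 × c₀ ≡ 1
  level-counts {c₀} {cw} {cb} total first second = cb≡θ₄ , trans cw≡pθ₄ (sym q⁴-1≡) , c₀≡1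
    where
    first′ : (b + d) * cw + b * cb ≡ (b + d) * (p * θ q 4) + b * θ q 4
    first′ = trans (cong₂ (λ w v → w * cw + v * cb) (sym white≡) (sym black≡))
                   (trans first (trans (cong (_* θ q 4) size≡) (sym first-identity)))
    second′ : (b + d) * (b + d) * cw + b * b * cb ≡ (b + d) * (b + d) * (p * θ q 4) + b * b * θ q 4
    second′ = trans (cong₂ (λ w v → w * w * cw + v * v * cb) (sym white≡) (sym black≡))
                    (trans second (trans (cong (λ s → s * (θ q 3 * s + q ^ 3)) size≡) (sym second-identity)))
    nonzero-levels : cw ≡ p * θ q 4 × cb ≡ θ q 4
    nonzero-levels = two-moments-determine b d first′ second′
    cw≡pθ₄ : cw ≡ p * θ q 4
    cw≡pθ₄ = proj₁ nonzero-levels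
    cb≡θ₄ : cb ≡ θ q 4
    cb≡θ₄ = proj₂ nonzero-levels
    c₀≡1 : c₀ ≡ 1
    c₀≡1 = ℕ.+-cancelʳ-≡ (p * θ q 4) _ _ (ℕ.+-cancelʳ-≡ (θ q 4) _ _ (begin
      c₀ + p * θ q 4 + θ q 4  ≡⟨ cong₂ (λ w v → c₀ + w + v) cw≡pθ₄ cb≡θ₄ ⟨
      c₀ + cw + cb            ≡⟨ total ⟩
      θ q 5                   ≡⟨ θ₅≡ ⟩
      1 + p * θ q 4 + θ q 4   ∎))
      where open ≡-Reasoning

  black≢0 : black ≢ 0
  black≢0 black≡0 = ≢-nonZero⁻¹ b (trans (sym black≡) black≡0)

  white≢0 : white ≢ 0
  white≢0 white≡0 = ≢-nonZero⁻¹ (b + d) (trans (sym white≡) white≡0)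

  white≢black : white ≢ black
  white≢black white≡black = ≢-nonZero⁻¹ d (ℕ.+-cancelˡ-≡ b d 0 (begin
    b + d  ≡⟨ white≡ ⟨
    white  ≡⟨ white≡black ⟩
    black  ≡⟨ black≡ ⟩
    b      ≡⟨ ℕ.+-identityʳ b ⟨
    b + 0  ∎))
    where open ≡-Reasoning


lemma2p10 : (q k : ℕ) → q ≡ 2 * k → 2 < q → (F : FiniteField q) → (E : PG.V5 F → Bool) →
  (∀ x → x ∈ PG.points F →
    PG.pointDeg F E x ≡ 0 ⊎ PG.pointDeg F E x ≡ k * q ^ 2 ⊎ PG.pointDeg F E x ≡ k * q ^ 2 ∸ k * q) →
  (∀ u v → u ∈ PG.solids F → v ∈ PG.solids F → PG.distinctVec F u v ≡ true →
    PG.planeDeg F E u v ≡ 0 ⊎ PG.planeDeg F E u v ≡ k ⊎ PG.planeDeg F E u v ≡ q) →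
  PG.sizeE F E ≡ k * q * (q ^ 2 ∸ 1) →
  PG.count F (λ x → PG.pointDeg F E x ≡ᵇ (k * q ^ 2 ∸ k * q)) (PG.points F) ≡ q ^ 3 + q ^ 2 + q + 1
  × PG.count F (λ x → PG.pointDeg F E x ≡ᵇ (k * q ^ 2)) (PG.points F) ≡ q ^ 4 ∸ 1
  × PG.count F (λ x → PG.pointDeg F E x ≡ᵇ 0) (PG.points F) ≡ 1
lemma2p10 .(2 * zero)  zero    refl ()
lemma2p10 .(2 * suc m) (suc m) refl _ F E degrees _ |E| =
  map₁ (λ black≡θ₄ → trans black≡θ₄ (θ-4 q)) (level-counts zeroth first second)
  where
  open Parameters m
  open PG F using (points; pointDeg)
  open Incidence F
  open DoubleCounting E
  open ThreeValued (pointDeg E) white≢0 black≢0 white≢black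
  zeroth : level 0 points + level white points + level black points ≡ θ q 5
  zeroth = trans (levels-total points degrees) #points
  first : white * level white points + black * level black points ≡ size * θ q 4
  first = trans (sym (levels-first points degrees)) (trans first-moment (cong (_* θ q 4) |E|))
  second : white * white * level white points + black * black * level black points ≡ size * (θ q 3 * size + q ^ 3)
  second = trans (sym (levels-second points degrees)) (trans second-moment (cong (λ e → e * (θ q 3 * e + q ^ 3)) |E|))
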